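{- Let $k\geq 1$ be an integer, let $R$ be a commutative ring, let $a,K\in R$, and let $(x_n)_{n\in\mathbb{Z}}$ be an arbitrary sequence of elements of $R$. Define, for all $n\in\mathbb{Z}$, $$\xi_n := x_n x_{n+2k+1}-x_{n+2k}x_{n+1} - a\,(x_{n+k}+x_{n+k+1}),$$ $$y_n := x_{n+6k}-K\,(x_{n+4k}-x_{n+2k})-x_n .$$ Then for all $n\in\mathbb{Z}$, $$\xi_{n+6k}-K\,(\xi_{n+4k}-\xi_{n+2k})-\xi_n = x_{n+6k}\,y_{n+2k+1}-x_{n+6k+1}\,y_{n+2k}-x_{n+2k}\,y_{n+1}+x_{n+2k+1}\,y_n-a\,(y_{n+k+1}+y_{n+k}).$$
   Context: In operator language: with $\mathcal{S}$ the shift $\mathcal{S}x_n=x_{n+1}$, $\mathcal{L}=\mathcal{S}^{6k}-K(\mathcal{S}^{4k}-\mathcal{S}^{2k})-1$ and $\mathcal{M}_n=x_{n+6k}\mathcal{S}^{2k+1}-x_{n+6k+1}\mathcal{S}^{2k}-x_{n+2k}\mathcal{S}+x_{n+2k+1}-a(\mathcal{S}^{k+1}+\mathcal{S}^k)$, the claim reads $\mathcal{L}\xi_n=\mathcal{M}_n\cdot\mathcal{L}x_n$; here $y_n=\mathcal{L}x_n$. -}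

module Defs where

open import Level using (Level)
open import Algebra.Bundles using (CommutativeRing)
open import Data.Nat using (ℕ)
open import Data.Integer using (ℤ; +_)
import Data.Integer as ℤ

module Seq {c ℓ : Level} (R : CommutativeRing c ℓ) where
  open CommutativeRing R

  ξ : (k : ℕ) (a : Carrier) (x : ℤ → Carrier) → ℤ → Carrier
  ξ k a x n =
    x n * x (n ℤ.+ (+ (2 ℕ.* k ℕ.+ 1)))
    - x (n ℤ.+ (+ (2 ℕ.* k))) * x (n ℤ.+ (+ 1))
    - a * (x (n ℤ.+ (+ k)) + x (n ℤ.+ (+ (k ℕ.+ 1))))
    where import Data.Nat as ℕ

  y : (k : ℕ) (K : Carrier) (x : ℤ → Carrier) → ℤ → Carrier
  y k K x n =
    x (n ℤ.+ (+ (6 ℕ.* k)))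
    - K * (x (n ℤ.+ (+ (4 ℕ.* k))) - x (n ℤ.+ (+ (2 ℕ.* k))))
    - x n
    where import Data.Nat as ℕ

-- Every index occurring on either side has the form n + ik + j with 0 ≤ i ≤ 8 and j ∈ {0, 1},
-- and the shifts by 2k, 4k, 6k, k, 1 only move along this grid.  Reading x on the grid therefore
-- turns the identity 𝓛ξ = 𝓜·𝓛x into a polynomial identity in a, K and the eighteen values
-- x_{n+ik+j}, which holds in ℤ[a, K, x_{n+ik+j}] and hence in every commutative ring.
module Submission where

open import Defs
open import Level using (Level)
open import Algebra.Bundles using (CommutativeRing)
open import Algebra.Bundles.Raw using (RawRing)
open import Algebra.Solver.Ring.AlmostCommutativeRing
  using (fromCommutativeRing; _-Raw-AlmostCommutative⟶_)
open import Data.Nat using (ℕ; zero; suc; _≥_)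
open import Data.Nat.DivMod using (_mod_; _/_; _%_)
open import Data.Nat.Tactic.RingSolver using (solve-∀)
open import Data.Integer using (ℤ; +_; -[1+_]; _⊖_)
open import Data.Fin using (toℕ; #_; _↑ʳ_)
open import Data.Vec using (_∷_; tabulate)
open import Data.Maybe using (Maybe; just; nothing)
open import Relation.Nullary using (yes; no)
open import Relation.Binary.PropositionalEquality as ≡ using (_≡_)
import Relation.Binary.Reasoning.Setoid as SetoidReasoning
import Data.Nat as ℕ
import Data.Nat.Properties as ℕₚ
import Data.Integer as ℤ
import Data.Integer.Properties as ℤₚ

-- The ring solver only succeeds when its coefficients compute, so a commutative ring is
-- solved over ℤ through the canonical homomorphism ℤ → R.
module IntegerCoefficients {c ℓ : Level} (R : CommutativeRing c ℓ) where
  open CommutativeRing R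
  open import Algebra.Properties.Ring ring using (-0#≈0#; -‿distribˡ-*; -‿distribʳ-*; -‿involutive)
  open import Algebra.Properties.AbelianGroup +-abelianGroup using (⁻¹-∙-comm)
  open import Algebra.Properties.CommutativeSemigroup +-commutativeSemigroup using (interchange)
  open import Algebra.Properties.Monoid.Mult +-monoid using (_×_; ×-homo-+)
  open import Algebra.Properties.Semiring.Mult semiring using (×1-homo-*)
  open SetoidReasoning setoid

  fromℕ : ℕ → Carrier
  fromℕ m = m × 1#

  fromℤ : ℤ → Carrier
  fromℤ (+ m)    = fromℕ m
  fromℤ -[1+ m ] = - fromℕ (suc m)

  fromℤ-cong : ∀ {i j} → i ≡ j → fromℤ i ≈ fromℤ j
  fromℤ-cong i≡j = reflexive (≡.cong fromℤ i≡j)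

  fromℤ-⊖ : ∀ m n → fromℤ (m ⊖ n) ≈ fromℕ m - fromℕ n
  fromℤ-⊖ zero    zero    = sym (-‿inverseʳ 0#)
  fromℤ-⊖ (suc m) zero    = begin
    fromℕ (suc m)        ≈⟨ sym (+-identityʳ _) ⟩
    fromℕ (suc m) + 0#   ≈⟨ +-congˡ (sym -0#≈0#) ⟩
    fromℕ (suc m) - 0#   ∎
  fromℤ-⊖ zero    (suc n) = sym (+-identityˡ _)
  fromℤ-⊖ (suc m) (suc n) = begin
    fromℤ (suc m ⊖ suc n)             ≈⟨ fromℤ-cong (ℤₚ.[1+m]⊖[1+n]≡m⊖n m n) ⟩
    fromℤ (m ⊖ n)                     ≈⟨ fromℤ-⊖ m n ⟩
    fromℕ m - fromℕ n                 ≈⟨ sym (+-identityˡ _) ⟩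
    0# + (fromℕ m - fromℕ n)          ≈⟨ +-congʳ (sym (-‿inverseʳ 1#)) ⟩
    (1# - 1#) + (fromℕ m - fromℕ n)   ≈⟨ interchange 1# (- 1#) (fromℕ m) (- fromℕ n) ⟩
    (1# + fromℕ m) + (- 1# - fromℕ n) ≈⟨ +-congˡ (⁻¹-∙-comm 1# (fromℕ n)) ⟩
    fromℕ (suc m) - fromℕ (suc n)     ∎

  fromℤ-+ : ∀ i j → fromℤ (i ℤ.+ j) ≈ fromℤ i + fromℤ j
  fromℤ-+ (+ m)    (+ n)    = ×-homo-+ 1# m n
  fromℤ-+ (+ m)    -[1+ n ] = fromℤ-⊖ m (suc n)
  fromℤ-+ -[1+ m ] (+ n)    = trans (fromℤ-⊖ n (suc m)) (+-comm _ _)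
  fromℤ-+ -[1+ m ] -[1+ n ] = begin
    - fromℕ (suc (suc (m ℕ.+ n)))     ≈⟨ -‿cong (reflexive (≡.cong (λ l → fromℕ (suc l)) (≡.sym (ℕₚ.+-suc m n)))) ⟩
    - fromℕ (suc m ℕ.+ suc n)         ≈⟨ -‿cong (×-homo-+ 1# (suc m) (suc n)) ⟩
    - (fromℕ (suc m) + fromℕ (suc n)) ≈⟨ sym (⁻¹-∙-comm _ _) ⟩
    - fromℕ (suc m) - fromℕ (suc n)   ∎

  fromℤ-neg : ∀ i → fromℤ (ℤ.- i) ≈ - fromℤ i
  fromℤ-neg (+ zero)  = sym -0#≈0#
  fromℤ-neg (+ suc n) = refl
  fromℤ-neg -[1+ n ]  = sym (-‿involutive _)

  fromℤ-*-+ : ∀ m n → fromℤ (+ m ℤ.* + n) ≈ fromℕ m * fromℕ n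
  fromℤ-*-+ m n = trans (fromℤ-cong (≡.sym (ℤₚ.pos-* m n))) (×1-homo-* m n)

  fromℤ-*ˡ : ∀ m j → fromℤ (+ m ℤ.* j) ≈ fromℕ m * fromℤ j
  fromℤ-*ˡ m (+ n)    = fromℤ-*-+ m n
  fromℤ-*ˡ m -[1+ n ] = begin
    fromℤ (+ m ℤ.* ℤ.- + suc n)   ≈⟨ fromℤ-cong (≡.sym (ℤₚ.neg-distribʳ-* (+ m) (+ suc n))) ⟩
    fromℤ (ℤ.- (+ m ℤ.* + suc n)) ≈⟨ fromℤ-neg (+ m ℤ.* + suc n) ⟩
    - fromℤ (+ m ℤ.* + suc n)     ≈⟨ -‿cong (fromℤ-*-+ m (suc n)) ⟩
    - (fromℕ m * fromℕ (suc n))   ≈⟨ -‿distribʳ-* _ _ ⟩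
    fromℕ m * - fromℕ (suc n)     ∎

  fromℤ-* : ∀ i j → fromℤ (i ℤ.* j) ≈ fromℤ i * fromℤ j
  fromℤ-* (+ m)    j = fromℤ-*ˡ m j
  fromℤ-* -[1+ m ] j = begin
    fromℤ (ℤ.- + suc m ℤ.* j)     ≈⟨ fromℤ-cong (≡.sym (ℤₚ.neg-distribˡ-* (+ suc m) j)) ⟩
    fromℤ (ℤ.- (+ suc m ℤ.* j))   ≈⟨ fromℤ-neg (+ suc m ℤ.* j) ⟩
    - fromℤ (+ suc m ℤ.* j)       ≈⟨ -‿cong (fromℤ-*ˡ (suc m) j) ⟩
    - (fromℕ (suc m) * fromℤ j)   ≈⟨ -‿distribˡ-* _ _ ⟩
    - fromℕ (suc m) * fromℤ j     ∎

  fromℤ-morphism : ℤ.+-*-rawRing -Raw-AlmostCommutative⟶ fromCommutativeRing R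
  fromℤ-morphism = record
    { ⟦_⟧    = fromℤ
    ; +-homo = fromℤ-+
    ; *-homo = fromℤ-*
    ; -‿homo = fromℤ-neg
    ; 0-homo = refl
    ; 1-homo = +-identityʳ 1#
    }

  fromℤ-≟ : ∀ i j → Maybe (fromℤ i ≈ fromℤ j)
  fromℤ-≟ i j with i ℤ.≟ j
  ... | yes i≡j = just (fromℤ-cong i≡j)
  ... | no  _   = nothing

  open import Algebra.Solver.Ring ℤ.+-*-rawRing (fromCommutativeRing R) fromℤ-morphism fromℤ-≟ public
    using (Polynomial; var; con; _:+_; _:*_; :-_; prove)

  polynomialRawRing : ℕ → RawRing _ _
  polynomialRawRing m = record
    { Carrier = Polynomial m ; _≈_ = _≡_ ; _+_ = _:+_ ; _*_ = _:*_ ; -_ = :-_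
    ; 0# = con (+ 0) ; 1# = con (+ 1) }

-- The two sides of the identity for a sequence read on the grid, z i j = x_{n+ik+j}.
-- Shifts are written p + i rather than i + p so that they reduce for literal p.
module Grid {c ℓ : Level} (A : RawRing c ℓ) (a K : RawRing.Carrier A) where
  open RawRing A

  infixl 6 _-_
  _-_ : Carrier → Carrier → Carrier
  x - y = x + - y

  L̂ : (ℕ → ℕ → Carrier) → ℕ → ℕ → Carrier
  L̂ s i j = s (6 ℕ.+ i) j - K * (s (4 ℕ.+ i) j - s (2 ℕ.+ i) j) - s i j

  ξ̂ : (ℕ → ℕ → Carrier) → ℕ → ℕ → Carrier
  ξ̂ z i j = z i j * z (2 ℕ.+ i) (1 ℕ.+ j) - z (2 ℕ.+ i) j * z i (1 ℕ.+ j)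
            - a * (z (1 ℕ.+ i) j + z (1 ℕ.+ i) (1 ℕ.+ j))

  M̂ : (z t : ℕ → ℕ → Carrier) → Carrier
  M̂ z t = z 6 0 * t 2 1 - z 6 1 * t 2 0 - z 2 0 * t 0 1 + z 2 1 * t 0 0 - a * (t 1 1 + t 1 0)

module _ {c ℓ : Level} (R : CommutativeRing c ℓ) where
  open CommutativeRing R using (Carrier; _≈_; rawRing; refl)
  open IntegerCoefficients R using (Polynomial; var; prove; polynomialRawRing)

  -- Variables 0 and 1 are a and K; z i j is variable 2 + (2i + j), inverted by the environment below.
  gridVar : ℕ → ℕ → Polynomial 20
  gridVar i j = var (2 ↑ʳ ((2 ℕ.* i ℕ.+ j) mod 18))

  grid-identity : ∀ a K (z : ℕ → ℕ → Carrier) → let open Grid rawRing a K in L̂ (ξ̂ z) 0 0 ≈ M̂ z (L̂ z)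
  grid-identity a K z = prove (a ∷ K ∷ tabulate (λ v → z (toℕ v / 2) (toℕ v % 2)))
    (L̂ (ξ̂ gridVar) 0 0) (M̂ gridVar (L̂ gridVar)) refl
    where open Grid (polynomialRawRing 20) (var (# 0)) (var (# 1))

-- In the notation of the paper, y k K s is 𝓛 s and M x s is 𝓜 applied to s.
module Operator {c ℓ : Level} (R : CommutativeRing c ℓ) (k : ℕ) (a : CommutativeRing.Carrier R) where
  open CommutativeRing R

  M : (x s : ℤ → Carrier) → ℤ → Carrier
  M x s m = x (m ℤ.+ + (6 ℕ.* k)) * s (m ℤ.+ + (2 ℕ.* k ℕ.+ 1))
          - x (m ℤ.+ + (6 ℕ.* k ℕ.+ 1)) * s (m ℤ.+ + (2 ℕ.* k))
          - x (m ℤ.+ + (2 ℕ.* k)) * s (m ℤ.+ + 1)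
          + x (m ℤ.+ + (2 ℕ.* k ℕ.+ 1)) * s m
          - a * (s (m ℤ.+ + (k ℕ.+ 1)) + s (m ℤ.+ + k))

grid-+ : ∀ i j p q k → (i ℕ.* k ℕ.+ j) ℕ.+ (p ℕ.* k ℕ.+ q) ≡ (p ℕ.+ i) ℕ.* k ℕ.+ (q ℕ.+ j)
grid-+ = solve-∀

module Sampling {c ℓ : Level} (R : CommutativeRing c ℓ) (k : ℕ) (a K : CommutativeRing.Carrier R) (n : ℤ) where
  open CommutativeRing R
  open Seq R
  open Operator R k a
  open Grid rawRing a K using (L̂; ξ̂; M̂)

  record OnGrid (s : ℤ → Carrier) (t : ℕ → ℕ → Carrier) : Set c where
    constructor onGrid
    field
      sample : ∀ {e} i j → e ≡ i ℕ.* k ℕ.+ j → s (n ℤ.+ + e) ≡ t i j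
  open OnGrid

  sampled : (ℤ → Carrier) → ℕ → ℕ → Carrier
  sampled x i j = x (n ℤ.+ + (i ℕ.* k ℕ.+ j))

  sampled-on-grid : ∀ x → OnGrid x (sampled x)
  sampled-on-grid x = onGrid λ i j e≡ → ≡.cong (λ e → x (n ℤ.+ + e)) e≡

  at-origin : ∀ {s t} → OnGrid s t → s n ≡ t 0 0
  at-origin {s} s∼t = ≡.trans (≡.cong s (≡.sym (ℤₚ.+-identityʳ n))) (sample s∼t 0 0 ≡.refl)

  shift : ∀ {s t e o} i j p q → OnGrid s t → e ≡ i ℕ.* k ℕ.+ j → o ≡ p ℕ.* k ℕ.+ q →
          s ((n ℤ.+ + e) ℤ.+ + o) ≡ t (p ℕ.+ i) (q ℕ.+ j)
  shift {s} {e = e} {o} i j p q s∼t ≡.refl ≡.refl =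
    ≡.trans (≡.cong s index) (sample s∼t (p ℕ.+ i) (q ℕ.+ j) (grid-+ i j p q k))
    where
    index : (n ℤ.+ + e) ℤ.+ + o ≡ n ℤ.+ + (e ℕ.+ o)
    index = ≡.trans (ℤₚ.+-assoc n (+ e) (+ o)) (≡.cong (ℤ._+_ n) (≡.sym (ℤₚ.pos-+ e o)))

  p*k≡p*k+0 : ∀ p → p ℕ.* k ≡ p ℕ.* k ℕ.+ 0
  p*k≡p*k+0 p = ≡.sym (ℕₚ.+-identityʳ _)

  k≡1*k+0 : k ≡ 1 ℕ.* k ℕ.+ 0
  k≡1*k+0 = ≡.trans (≡.sym (ℕₚ.*-identityˡ k)) (p*k≡p*k+0 1)

  k+1≡1*k+1 : k ℕ.+ 1 ≡ 1 ℕ.* k ℕ.+ 1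
  k+1≡1*k+1 = ≡.cong (ℕ._+ 1) (≡.sym (ℕₚ.*-identityˡ k))

  ξ-on-grid : ∀ {x z} → OnGrid x z → OnGrid (ξ k a x) (ξ̂ z)
  ξ-on-grid x∼z = onGrid λ i j e≡ → ≡.cong₂ _-_
    (≡.cong₂ _-_ (≡.cong₂ _*_ (sample x∼z i j e≡) (shift i j 2 1 x∼z e≡ ≡.refl))
                 (≡.cong₂ _*_ (shift i j 2 0 x∼z e≡ (p*k≡p*k+0 2)) (shift i j 0 1 x∼z e≡ ≡.refl)))
    (≡.cong (a *_) (≡.cong₂ _+_ (shift i j 1 0 x∼z e≡ k≡1*k+0) (shift i j 1 1 x∼z e≡ k+1≡1*k+1)))

  L-on-grid : ∀ {s t} → OnGrid s t → OnGrid (y k K s) (L̂ t)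
  L-on-grid s∼t = onGrid λ i j e≡ → ≡.cong₂ _-_
    (≡.cong₂ _-_ (shift i j 6 0 s∼t e≡ (p*k≡p*k+0 6))
                 (≡.cong (K *_) (≡.cong₂ _-_ (shift i j 4 0 s∼t e≡ (p*k≡p*k+0 4))
                                             (shift i j 2 0 s∼t e≡ (p*k≡p*k+0 2)))))
    (sample s∼t i j e≡)

  M-on-grid : ∀ {x z s t} → OnGrid x z → OnGrid s t → M x s n ≡ M̂ z t
  M-on-grid x∼z s∼t = ≡.cong₂ _-_
    (≡.cong₂ _+_
      (≡.cong₂ _-_
        (≡.cong₂ _-_ (≡.cong₂ _*_ (sample x∼z 6 0 (p*k≡p*k+0 6)) (sample s∼t 2 1 ≡.refl))
                     (≡.cong₂ _*_ (sample x∼z 6 1 ≡.refl) (sample s∼t 2 0 (p*k≡p*k+0 2))))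
        (≡.cong₂ _*_ (sample x∼z 2 0 (p*k≡p*k+0 2)) (sample s∼t 0 1 ≡.refl)))
      (≡.cong₂ _*_ (sample x∼z 2 1 ≡.refl) (at-origin s∼t)))
    (≡.cong (a *_) (≡.cong₂ _+_ (sample s∼t 1 1 k+1≡1*k+1) (sample s∼t 1 0 k≡1*k+0)))

lemma1p2 : {c ℓ : Level} (R : CommutativeRing c ℓ) (k : ℕ) → k ≥ 1 →
  (a K : CommutativeRing.Carrier R) (x : ℤ → CommutativeRing.Carrier R) (n : ℤ) →
  let open CommutativeRing R
      open Seq R
      ξ' = ξ k a x
      y' = y k K x
      _⊕_ = ℤ._+_
  in ξ' (n ⊕ (+ (6 ℕ.* k))) - K * (ξ' (n ⊕ (+ (4 ℕ.* k))) - ξ' (n ⊕ (+ (2 ℕ.* k)))) - ξ' n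
     ≈ x (n ⊕ (+ (6 ℕ.* k))) * y' (n ⊕ (+ (2 ℕ.* k ℕ.+ 1)))
       - x (n ⊕ (+ (6 ℕ.* k ℕ.+ 1))) * y' (n ⊕ (+ (2 ℕ.* k)))
       - x (n ⊕ (+ (2 ℕ.* k))) * y' (n ⊕ (+ 1))
       + x (n ⊕ (+ (2 ℕ.* k ℕ.+ 1))) * y' n
       - a * (y' (n ⊕ (+ (k ℕ.+ 1))) + y' (n ⊕ (+ k)))
lemma1p2 R k _ a K x n = begin
  y k K (ξ k a x) n   ≡⟨ at-origin (L-on-grid (ξ-on-grid x∼z)) ⟩
  L̂ (ξ̂ z) 0 0        ≈⟨ grid-identity R a K z ⟩
  M̂ z (L̂ z)           ≡⟨ M-on-grid x∼z (L-on-grid x∼z) ⟨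
  M x (y k K x) n     ∎
  where
  open CommutativeRing R using (Carrier; setoid; rawRing)
  open SetoidReasoning setoid
  open Seq R
  open Operator R k a
  open Sampling R k a K n
  open Grid rawRing a K using (L̂; ξ̂; M̂)

  z : ℕ → ℕ → Carrier
  z = sampled x

  x∼z : OnGrid x z
  x∼z = sampled-on-grid x
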